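{- Let $N$ be a natural number and let $q,a,b,e$ be complex numbers with $a,b,e\ne0$ and such that no denominator below vanishes. Then \[ \sum_{n=1}^{N} \begin{bmatrix} N\\ n \end{bmatrix} \frac{(-1)^n (q)_{n-1} (b/a)_{n} a^{n} q^{n(n+1)/2} }{(b)_{n} (q/e)_{n} e^n} = \sum_{n=1}^N \begin{bmatrix} N\\ n \end{bmatrix} \frac{(q)_{n-1} (b)_{N-n} (aq/be)_{n} b^n}{(b)_N (q/e)_{n}} - \sum_{n=1}^{N} \frac{bq^{n-1} }{1-bq^{n-1}}. \]
   Context: For complex $x$: $(x)_0=1$, $(x)_n=(1-x)(1-xq)\cdots(1-xq^{n-1})$ for $n\ge1$. The $q$-binomial coefficient is $\begin{bmatrix} N\\ n \end{bmatrix}=\frac{(q)_N}{(q)_n(q)_{N-n}}$ for $0\le n\le N$ and $0$ otherwise. -}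

module Defs where

open import Level using (Level; suc; _⊔_)
open import Data.Nat as ℕ using (ℕ; zero) renaming (suc to 1+)
open import Data.Nat.DivMod using (_/_)
open import Relation.Nullary using (¬_; yes; no)
open import Algebra.Bundles using (CommutativeRing)

-- A field: a commutative ring with 0 ≠ 1 and a (total) inverse operation
-- that inverts every nonzero element (0⁻¹ is fixed to be 0, as a harmless convention;
-- it is never used in the statement since all denominators are assumed nonzero).
record Field (c ℓ : Level) : Set (suc (c ⊔ ℓ)) where
  field
    commutativeRing : CommutativeRing c ℓ
  open CommutativeRing commutativeRing public
  infix 9 _⁻¹
  field
    _⁻¹      : Carrier → Carrier
    ⁻¹-cong  : ∀ {x y} → x ≈ y → x ⁻¹ ≈ y ⁻¹
    0≉1      : ¬ (0# ≈ 1#)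
    inverseʳ : ∀ x → ¬ (x ≈ 0#) → x * x ⁻¹ ≈ 1#
    0⁻¹≈0    : 0# ⁻¹ ≈ 0#

module FieldDefs {c ℓ : Level} (F : Field c ℓ) where
  open Field F

  infixl 7 _÷_
  _÷_ : Carrier → Carrier → Carrier
  x ÷ y = x * y ⁻¹

  pow : Carrier → ℕ → Carrier
  pow x zero = 1#
  pow x (1+ n) = pow x n * x

  poch : (q x : Carrier) → ℕ → Carrier
  poch q x zero = 1#
  poch q x (1+ n) = poch q x n * (1# - x * pow q n)

  qbinom : (q : Carrier) → (N n : ℕ) → Carrier
  qbinom q N n with n ℕ.≤? N
  ... | yes _ = poch q q N ÷ (poch q q n * poch q q (N ℕ.∸ n))
  ... | no _  = 0#

  sum1 : ℕ → (ℕ → Carrier) → Carrier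
  sum1 zero f = 0#
  sum1 (1+ N) f = sum1 N f + f (1+ N)

  tri : ℕ → ℕ
  tri n = (n ℕ.* 1+ n) / 2

{-# OPTIONS --safe #-}
module Submission where

-- Multiplying by (b;q)_N (q/e;q)_N turns the identity into a polynomial one.  Every sum in it
-- has the form Σ_k [n k] F k, and Pascal's rule [n+1 k+1] = [n k] + q^(k+1) [n k+1] rewrites
-- Σ_k [n+1 k] F k as Σ_k [n k] (q^k F k + F (k+1)).  By induction on n this gives the
-- q-Vandermonde sum (by)_M = Σ_j [M j] (y)_j (b)_(M-j) b^j, its y-derivative at y = 1, namely
-- Σ_j [M j] (q)_(j-1) (b)_(M-j) b^j = (b)_M Σ_n b q^(n-1) / (1 - b q^(n-1)), and the expansion
-- (ux)_n (xq^n)_(N-n) = Σ_k [n k] W_k (xq^k)_(N-k) with W_k = Π_(i<k) (q^i - u) x q^i.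
-- Take u = a/b and x = q/e.  Inserting the expansion into the right-hand side and interchanging
-- the two sums, the coefficient of W_k (xq^k)_(N-k) is, by [N n] [n k] = [N k] [N-k n-k],
-- again a q-Vandermonde sum: for k ≥ 1 it yields the k-th summand of the left-hand side (whose
-- numerator (-1)^k (b/a)_k a^k q^(k(k+1)/2) is e^k b^k W_k), and for k = 0 the derivative sum.

open import Defs
open import Level using (Level)
open import Algebra.Bundles using (CommutativeRing)
open import Algebra.Solver.Ring.AlmostCommutativeRing
  using (fromCommutativeRing; _-Raw-AlmostCommutative⟶_)
open import Data.Integer as ℤ using (ℤ; +_; -[1+_]; _⊖_; _◃_)
import Data.Integer.Properties as ℤ
open import Data.List using (_∷_; [])
open import Data.Maybe using (Maybe; just; nothing)
open import Data.Nat as ℕ using (ℕ; zero; suc; _≤_; _<_; _∸_; s≤s; z≤n)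
import Data.Nat.Properties as ℕ
open import Data.Nat.DivMod using (_/_; m*n/n≡m; +-distrib-/-∣ʳ)
open import Data.Nat.Divisibility using (n∣m*n)
import Data.Nat.Tactic.RingSolver as ℕ-Solver
open import Data.Product using (_×_; _,_; proj₁; proj₂)
open import Data.Sign as Sign using (Sign)
open import Relation.Binary.PropositionalEquality as ≡ using (_≡_)
open import Relation.Nullary using (¬_; yes; no; contradiction)

module IntegerCoefficientSolver {c ℓ : Level} (R : CommutativeRing c ℓ) where
  open CommutativeRing R
  open import Algebra.Properties.Ring ring
  open import Algebra.Properties.Semiring.Mult.TCOptimised semiring renaming (_×_ to _×′_)
  open import Algebra.Properties.CommutativeSemigroup +-commutativeSemigroup using (interchange)
  open import Relation.Binary.Reasoning.Setoid setoid

  ⟦_⟧ : ℤ → Carrier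
  ⟦ + n ⟧      = n ×′ 1#
  ⟦ -[1+ n ] ⟧ = - (suc n ×′ 1#)

  private
    signed : Sign → Carrier → Carrier
    signed Sign.+ x = x
    signed Sign.- x = - x

    ◃-homo : ∀ s n → ⟦ s ◃ n ⟧ ≈ signed s (n ×′ 1#)
    ◃-homo Sign.+ zero    = refl
    ◃-homo Sign.- zero    = sym -0#≈0#
    ◃-homo Sign.+ (suc n) = refl
    ◃-homo Sign.- (suc n) = refl

    ⊖-homo : ∀ m n → ⟦ m ⊖ n ⟧ ≈ m ×′ 1# - n ×′ 1#
    ⊖-homo m       zero    = sym (trans (+-congˡ -0#≈0#) (+-identityʳ _))
    ⊖-homo zero    (suc n) = sym (+-identityˡ _)
    ⊖-homo (suc m) (suc n) = begin
      ⟦ suc m ⊖ suc n ⟧                     ≡⟨ ≡.cong ⟦_⟧ (ℤ.[1+m]⊖[1+n]≡m⊖n m n) ⟩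
      ⟦ m ⊖ n ⟧                             ≈⟨ ⊖-homo m n ⟩
      m ×′ 1# - n ×′ 1#                     ≈⟨ +-identityˡ _ ⟨
      0# + (m ×′ 1# - n ×′ 1#)              ≈⟨ +-congʳ (-‿inverseʳ 1#) ⟨
      (1# - 1#) + (m ×′ 1# - n ×′ 1#)       ≈⟨ interchange 1# _ (- 1#) _ ⟨
      (1# + m ×′ 1#) + (- 1# - n ×′ 1#)     ≈⟨ +-cong (sym (1+× m 1#)) (-‿+-comm 1# _) ⟩
      suc m ×′ 1# - (1# + n ×′ 1#)          ≈⟨ +-congˡ (-‿cong (1+× n 1#)) ⟨
      suc m ×′ 1# - suc n ×′ 1#             ∎

    +-homo : ∀ i j → ⟦ i ℤ.+ j ⟧ ≈ ⟦ i ⟧ + ⟦ j ⟧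
    +-homo (+ m)      (+ n)      = ×-homo-+ 1# m n
    +-homo (+ m)      -[1+ n ]   = ⊖-homo m (suc n)
    +-homo -[1+ m ]   (+ n)      = trans (⊖-homo n (suc m)) (+-comm _ _)
    +-homo -[1+ m ]   -[1+ n ]   = begin
      - (suc (suc (m ℕ.+ n)) ×′ 1#)         ≡⟨ ≡.cong (λ k → - (suc k ×′ 1#)) (ℕ.+-suc m n) ⟨
      - ((suc m ℕ.+ suc n) ×′ 1#)           ≈⟨ -‿cong (×-homo-+ 1# (suc m) (suc n)) ⟩
      - (suc m ×′ 1# + suc n ×′ 1#)          ≈⟨ -‿+-comm _ _ ⟨
      - (suc m ×′ 1#) + - (suc n ×′ 1#)      ∎

    *-homo : ∀ i j → ⟦ i ℤ.* j ⟧ ≈ ⟦ i ⟧ * ⟦ j ⟧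
    *-homo i j = trans (◃-homo _ (ℤ.∣ i ∣ ℕ.* ℤ.∣ j ∣)) (signs i j)
      where
      signs : ∀ i j → signed (ℤ.sign i Sign.* ℤ.sign j) ((ℤ.∣ i ∣ ℕ.* ℤ.∣ j ∣) ×′ 1#) ≈ ⟦ i ⟧ * ⟦ j ⟧
      signs (+ m)    (+ n)    = ×1-homo-* m n
      signs (+ m)    -[1+ n ] = trans (-‿cong (×1-homo-* m (suc n))) (-‿distribʳ-* _ _)
      signs -[1+ m ] (+ n)    = trans (-‿cong (×1-homo-* (suc m) n)) (-‿distribˡ-* _ _)
      signs -[1+ m ] -[1+ n ] = begin
        (suc m ℕ.* suc n) ×′ 1#             ≈⟨ ×1-homo-* (suc m) (suc n) ⟩
        suc m ×′ 1# * suc n ×′ 1#            ≈⟨ -‿involutive _ ⟨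
        - - (suc m ×′ 1# * suc n ×′ 1#)      ≈⟨ -‿cong (-‿distribˡ-* _ _) ⟩
        - (- (suc m ×′ 1#) * suc n ×′ 1#)    ≈⟨ -‿distribʳ-* _ _ ⟩
        - (suc m ×′ 1#) * - (suc n ×′ 1#)    ∎

    -‿homo : ∀ i → ⟦ ℤ.- i ⟧ ≈ - ⟦ i ⟧
    -‿homo (+ zero)    = sym -0#≈0#
    -‿homo (+ suc n)   = refl
    -‿homo -[1+ n ]    = sym (-‿involutive _)

    homomorphism : ℤ.+-*-rawRing -Raw-AlmostCommutative⟶ fromCommutativeRing R
    homomorphism = record
      { ⟦_⟧ = ⟦_⟧ ; +-homo = +-homo ; *-homo = *-homo ; -‿homo = -‿homo
      ; 0-homo = refl ; 1-homo = refl }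

    decideCoefficients : ∀ i j → Maybe (⟦ i ⟧ ≈ ⟦ j ⟧)
    decideCoefficients i j with i ℤ.≟ j
    ... | yes ≡.refl = just refl
    ... | no _       = nothing

  open import Algebra.Solver.Ring ℤ.+-*-rawRing (fromCommutativeRing R) homomorphism decideCoefficients public
    using (solve; Polynomial; _:=_; _:+_; _:*_; _:-_; :-_; con)

  :0 :1 : ∀ {n} → Polynomial n
  :0 = con (+ 0)
  :1 = con (+ 1)

m∸k+[n∸m]≡n∸k : ∀ {k m n} → k ≤ m → m ≤ n → m ∸ k ℕ.+ (n ∸ m) ≡ n ∸ k
m∸k+[n∸m]≡n∸k z≤n       m≤n       = ℕ.m+[n∸m]≡n m≤n
m∸k+[n∸m]≡n∸k (s≤s k≤m) (s≤s m≤n) = m∸k+[n∸m]≡n∸k k≤m m≤n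

module FiniteSums {c ℓ : Level} (R : CommutativeRing c ℓ) where
  open CommutativeRing R
  open import Algebra.Properties.CommutativeSemigroup +-commutativeSemigroup using (interchange)
  open import Relation.Binary.Reasoning.Setoid setoid

  sum< : ℕ → (ℕ → Carrier) → Carrier
  sum< zero    f = 0#
  sum< (suc n) f = sum< n f + f n

  sum<-cong : ∀ n {f g : ℕ → Carrier} → (∀ i → i < n → f i ≈ g i) → sum< n f ≈ sum< n g
  sum<-cong zero    f≈g = refl
  sum<-cong (suc n) f≈g = +-cong (sum<-cong n (λ i i<n → f≈g i (ℕ.m<n⇒m<1+n i<n))) (f≈g n (ℕ.n<1+n n))

  sum<-zero : ∀ n {f : ℕ → Carrier} → (∀ i → i < n → f i ≈ 0#) → sum< n f ≈ 0#
  sum<-zero zero    f≈0 = refl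
  sum<-zero (suc n) f≈0 =
    trans (+-cong (sum<-zero n (λ i i<n → f≈0 i (ℕ.m<n⇒m<1+n i<n))) (f≈0 n (ℕ.n<1+n n))) (+-identityˡ 0#)

  sum<-+ : ∀ n (f g : ℕ → Carrier) → sum< n (λ i → f i + g i) ≈ sum< n f + sum< n g
  sum<-+ zero    f g = sym (+-identityˡ 0#)
  sum<-+ (suc n) f g = begin
    sum< n (λ i → f i + g i) + (f n + g n)  ≈⟨ +-congʳ (sum<-+ n f g) ⟩
    (sum< n f + sum< n g) + (f n + g n)     ≈⟨ interchange _ _ _ _ ⟩
    sum< (suc n) f + sum< (suc n) g         ∎

  *-distribˡ-sum< : ∀ n x (f : ℕ → Carrier) → x * sum< n f ≈ sum< n (λ i → x * f i)
  *-distribˡ-sum< zero    x f = zeroʳ x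
  *-distribˡ-sum< (suc n) x f = trans (distribˡ x _ _) (+-congʳ (*-distribˡ-sum< n x f))

  *-distribʳ-sum< : ∀ n x (f : ℕ → Carrier) → sum< n f * x ≈ sum< n (λ i → f i * x)
  *-distribʳ-sum< n x f =
    trans (*-comm _ x) (trans (*-distribˡ-sum< n x f) (sum<-cong n (λ i _ → *-comm x (f i))))

  sum<-suc : ∀ n (f : ℕ → Carrier) → sum< (suc n) f ≈ f 0 + sum< n (λ i → f (suc i))
  sum<-suc zero    f = trans (+-identityˡ _) (sym (+-identityʳ _))
  sum<-suc (suc n) f = trans (+-congʳ (sum<-suc n f)) (+-assoc _ _ _)

  sum<-+-range : ∀ m n (f : ℕ → Carrier) → sum< (m ℕ.+ n) f ≈ sum< m f + sum< n (λ i → f (m ℕ.+ i))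
  sum<-+-range m zero    f = begin
    sum< (m ℕ.+ 0) f  ≡⟨ ≡.cong (λ k → sum< k f) (ℕ.+-identityʳ m) ⟩
    sum< m f          ≈⟨ +-identityʳ _ ⟨
    sum< m f + 0#     ∎
  sum<-+-range m (suc n) f = begin
    sum< (m ℕ.+ suc n) f                                     ≡⟨ ≡.cong (λ k → sum< k f) (ℕ.+-suc m n) ⟩
    sum< (m ℕ.+ n) f + f (m ℕ.+ n)                           ≈⟨ +-congʳ (sum<-+-range m n f) ⟩
    (sum< m f + sum< n (λ i → f (m ℕ.+ i))) + f (m ℕ.+ n)    ≈⟨ +-assoc _ _ _ ⟩
    sum< m f + sum< (suc n) (λ i → f (m ℕ.+ i))              ∎

  sum<-extend : ∀ {m n} {f : ℕ → Carrier} → m ≤ n → (∀ i → m ≤ i → f i ≈ 0#) → sum< m f ≈ sum< n f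
  sum<-extend {m} {f = f} m≤n f≈0 with ℕ.m≤n⇒∃[o]m+o≡n m≤n
  ... | o , ≡.refl = begin
    sum< m f                                ≈⟨ +-identityʳ _ ⟨
    sum< m f + 0#                           ≈⟨ +-congˡ (sum<-zero o (λ i _ → f≈0 (m ℕ.+ i) (ℕ.m≤m+n m i))) ⟨
    sum< m f + sum< o (λ i → f (m ℕ.+ i))   ≈⟨ sum<-+-range m o f ⟨
    sum< (m ℕ.+ o) f                        ∎

  sum<-interchange : ∀ m n (a : ℕ → Carrier) (f : ℕ → ℕ → Carrier) →
    sum< m (λ i → a i * sum< n (f i)) ≈ sum< n (λ j → sum< m (λ i → a i * f i j))
  sum<-interchange zero    n a f = sym (sum<-zero n (λ _ _ → refl))
  sum<-interchange (suc m) n a f = begin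
    sum< m (λ i → a i * sum< n (f i)) + a m * sum< n (f m)
      ≈⟨ +-cong (sum<-interchange m n a f) (*-distribˡ-sum< n (a m) (f m)) ⟩
    sum< n (λ j → sum< m (λ i → a i * f i j)) + sum< n (λ j → a m * f m j)
      ≈⟨ sum<-+ n _ _ ⟨
    sum< n (λ j → sum< (suc m) (λ i → a i * f i j)) ∎

module FieldProperties {c ℓ : Level} (F : Field c ℓ) where
  open Field F
  open FieldDefs F
  open FiniteSums commutativeRing
  open import Algebra.Properties.CommutativeSemigroup *-commutativeSemigroup using (interchange)
  open import Relation.Binary.Reasoning.Setoid setoid

  1≉0 : 1# ≉ 0#
  1≉0 1≈0 = 0≉1 (sym 1≈0)

  *-cancelʳ : ∀ {x y z} → z ≉ 0# → x * z ≈ y * z → x ≈ y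
  *-cancelʳ {x} {y} {z} z≉0 xz≈yz = begin
    x                ≈⟨ *-identityʳ x ⟨
    x * 1#           ≈⟨ *-congˡ (inverseʳ z z≉0) ⟨
    x * (z * z ⁻¹)   ≈⟨ *-assoc x z _ ⟨
    x * z * z ⁻¹     ≈⟨ *-congʳ xz≈yz ⟩
    y * z * z ⁻¹     ≈⟨ *-assoc y z _ ⟩
    y * (z * z ⁻¹)   ≈⟨ *-congˡ (inverseʳ z z≉0) ⟩
    y * 1#           ≈⟨ *-identityʳ y ⟩
    y                ∎

  x*y≉0 : ∀ {x y} → x ≉ 0# → y ≉ 0# → x * y ≉ 0#
  x*y≉0 {x} {y} x≉0 y≉0 xy≈0 = y≉0 (*-cancelʳ x≉0 (begin
    y * x   ≈⟨ *-comm y x ⟩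
    x * y   ≈⟨ xy≈0 ⟩
    0#      ≈⟨ zeroˡ x ⟨
    0# * x  ∎))

  x*y≉0⇒x≉0 : ∀ {x y} → x * y ≉ 0# → x ≉ 0#
  x*y≉0⇒x≉0 {y = y} xy≉0 x≈0 = xy≉0 (trans (*-congʳ x≈0) (zeroˡ y))

  ≉0-resp-≈ : ∀ {x y} → x ≈ y → x ≉ 0# → y ≉ 0#
  ≉0-resp-≈ x≈y x≉0 y≈0 = x≉0 (trans x≈y y≈0)

  ÷-*-cancel : ∀ {x y} → y ≉ 0# → x ÷ y * y ≈ x
  ÷-*-cancel {x} {y} y≉0 = begin
    x * y ⁻¹ * y    ≈⟨ *-assoc x _ y ⟩
    x * (y ⁻¹ * y)  ≈⟨ *-congˡ (trans (*-comm _ y) (inverseʳ y y≉0)) ⟩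
    x * 1#          ≈⟨ *-identityʳ x ⟩
    x               ∎

  ÷-unique : ∀ {x y z} → y ≉ 0# → z * y ≈ x → x ÷ y ≈ z
  ÷-unique y≉0 zy≈x = *-cancelʳ y≉0 (trans (÷-*-cancel y≉0) (sym zy≈x))

  ÷-cong : ∀ {x x′ y y′} → x ≈ x′ → y ≈ y′ → x ÷ y ≈ x′ ÷ y′
  ÷-cong x≈x′ y≈y′ = *-cong x≈x′ (⁻¹-cong y≈y′)

  pow-+ : ∀ x m n → pow x (m ℕ.+ n) ≈ pow x m * pow x n
  pow-+ x m zero    = trans (reflexive (≡.cong (pow x) (ℕ.+-identityʳ m))) (sym (*-identityʳ _))
  pow-+ x m (suc n) = begin
    pow x (m ℕ.+ suc n)          ≡⟨ ≡.cong (pow x) (ℕ.+-suc m n) ⟩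
    pow x (m ℕ.+ n) * x          ≈⟨ *-congʳ (pow-+ x m n) ⟩
    pow x m * pow x n * x        ≈⟨ *-assoc _ _ _ ⟩
    pow x m * pow x (suc n)      ∎

  pow-distrib-* : ∀ x y n → pow (x * y) n ≈ pow x n * pow y n
  pow-distrib-* x y zero    = sym (*-identityˡ 1#)
  pow-distrib-* x y (suc n) = trans (*-congʳ (pow-distrib-* x y n)) (interchange (pow x n) (pow y n) x y)

  pow-≉0 : ∀ {x} n → x ≉ 0# → pow x n ≉ 0#
  pow-≉0 zero    x≉0 = 1≉0
  pow-≉0 (suc n) x≉0 = x*y≉0 (pow-≉0 n x≉0) x≉0

  tri-suc : ∀ n → tri (suc n) ≡ tri n ℕ.+ suc n
  tri-suc n = ≡.trans (≡.cong (_/ 2) expand)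
    (≡.trans (+-distrib-/-∣ʳ (n ℕ.* suc n) (n∣m*n (suc n))) (≡.cong (tri n ℕ.+_) (m*n/n≡m (suc n) 2)))
    where
    expand : suc n ℕ.* suc (suc n) ≡ n ℕ.* suc n ℕ.+ suc n ℕ.* 2
    expand = ℕ-Solver.solve (n ∷ [])

  sum1≈sum< : ∀ N (f : ℕ → Carrier) → sum1 N f ≈ sum< N (λ n → f (suc n))
  sum1≈sum< zero    f = refl
  sum1≈sum< (suc N) f = +-congʳ (sum1≈sum< N f)

  sum1-cong : ∀ N {f g : ℕ → Carrier} → (∀ n → n < N → f (suc n) ≈ g (suc n)) → sum1 N f ≈ sum1 N g
  sum1-cong zero    f≈g = refl
  sum1-cong (suc N) f≈g = +-cong (sum1-cong N (λ n n<N → f≈g n (ℕ.m<n⇒m<1+n n<N))) (f≈g N (ℕ.n<1+n N))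

  *-distribʳ-sum1 : ∀ N x (f : ℕ → Carrier) → sum1 N f * x ≈ sum1 N (λ n → f n * x)
  *-distribʳ-sum1 zero    x f = zeroˡ x
  *-distribʳ-sum1 (suc N) x f = trans (distribʳ x _ _) (+-congʳ (*-distribʳ-sum1 N x f))

  sum1-suc : ∀ N (f : ℕ → Carrier) → sum1 (suc N) f ≈ f 1 + sum1 N (λ n → f (suc n))
  sum1-suc N f = begin
    sum1 (suc N) f                                  ≈⟨ sum1≈sum< (suc N) f ⟩
    sum< (suc N) (λ n → f (suc n))                  ≈⟨ sum<-suc N _ ⟩
    f 1 + sum< N (λ n → f (suc (suc n)))            ≈⟨ +-congˡ (sum1≈sum< N _) ⟨
    f 1 + sum1 N (λ n → f (suc n))                  ∎

module GaussianBinomials {c ℓ : Level} (F : Field c ℓ) (q : Field.Carrier F) where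
  open Field F
  open FieldDefs F
  open FiniteSums commutativeRing
  open FieldProperties F
  open IntegerCoefficientSolver commutativeRing
  open import Algebra.Properties.CommutativeSemigroup *-commutativeSemigroup using (x∙yz≈y∙xz)
  open import Relation.Binary.Reasoning.Setoid setoid

  private
    Q : ℕ → Carrier
    Q = pow q

    P : Carrier → ℕ → Carrier
    P = poch q

  poch-cong : ∀ {x y} n → x ≈ y → P x n ≈ P y n
  poch-cong zero    x≈y = refl
  poch-cong (suc n) x≈y = *-cong (poch-cong n x≈y) (+-congˡ (-‿cong (*-congʳ x≈y)))

  poch-+ : ∀ x m n → P x (m ℕ.+ n) ≈ P x m * P (x * Q m) n
  poch-+ x m zero    = trans (reflexive (≡.cong (P x) (ℕ.+-identityʳ m))) (sym (*-identityʳ _))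
  poch-+ x m (suc n) = begin
    P x (m ℕ.+ suc n)                               ≡⟨ ≡.cong (P x) (ℕ.+-suc m n) ⟩
    P x (m ℕ.+ n) * (1# - x * Q (m ℕ.+ n))          ≈⟨ *-cong (poch-+ x m n) (+-congˡ (-‿cong (*-congˡ (pow-+ q m n)))) ⟩
    P x m * P (x * Q m) n * (1# - x * (Q m * Q n))
      ≈⟨ solve 5 (λ a b x y z → a :* b :* (:1 :- x :* (y :* z)) := a :* (b :* (:1 :- x :* y :* z)))
               refl _ _ x (Q m) (Q n) ⟩
    P x m * P (x * Q m) (suc n)                     ∎

  poch-suc : ∀ x n → P x (suc n) ≈ (1# - x) * P (x * q) n
  poch-suc x n = begin
    P x (1 ℕ.+ n)                            ≈⟨ poch-+ x 1 n ⟩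
    1# * (1# - x * 1#) * P (x * (1# * q)) n  ≈⟨ *-cong (solve 1 (λ x → :1 :* (:1 :- x :* :1) := :1 :- x) refl x)
                                                        (poch-cong n (*-congˡ (*-identityˡ q))) ⟩
    (1# - x) * P (x * q) n                   ∎

  poch-suc-∸ : ∀ x {j M} → j ≤ M → P x (suc M ∸ j) ≈ (1# - x) * P (x * q) (M ∸ j)
  poch-suc-∸ x {j} {M} j≤M = trans (reflexive (≡.cong (P x) (ℕ.+-∸-assoc 1 j≤M))) (poch-suc x (M ∸ j))

  poch-split : ∀ x {n N} → n ≤ N → P x N ≈ P x n * P (x * Q n) (N ∸ n)
  poch-split x {n} n≤N = trans (reflexive (≡.cong (P x) (≡.sym (ℕ.m+[n∸m]≡n n≤N)))) (poch-+ x n _)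

  poch≉0-from-1 : ∀ {x M} → (∀ n → 1 ≤ n → n ≤ M → P x n ≉ 0#) → P x M ≉ 0#
  poch≉0-from-1 {M = zero}  _      = 1≉0
  poch≉0-from-1 {M = suc M} Pxn≉0 = Pxn≉0 (suc M) (s≤s z≤n) ℕ.≤-refl

  -- Unlike qbinom, defined by Pascal's rule, hence without division.
  gauss : ℕ → ℕ → Carrier
  gauss zero    zero    = 1#
  gauss zero    (suc k) = 0#
  gauss (suc n) zero    = 1#
  gauss (suc n) (suc k) = gauss n k + Q (suc k) * gauss n (suc k)

  gauss-n-0 : ∀ n → gauss n 0 ≈ 1#
  gauss-n-0 zero    = refl
  gauss-n-0 (suc n) = refl

  gauss-over : ∀ {n k} → n < k → gauss n k ≈ 0#
  gauss-over {zero}  {suc k} _         = refl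
  gauss-over {suc n} {suc k} (s≤s n<k) = begin
    gauss n k + Q (suc k) * gauss n (suc k)  ≈⟨ +-cong (gauss-over n<k) (*-congˡ (gauss-over (ℕ.m<n⇒m<1+n n<k))) ⟩
    0# + Q (suc k) * 0#                      ≈⟨ trans (+-identityˡ _) (zeroʳ _) ⟩
    0#                                       ∎

  gauss-n-n : ∀ n → gauss n n ≈ 1#
  gauss-n-n zero    = refl
  gauss-n-n (suc n) = begin
    gauss n n + Q (suc n) * gauss n (suc n)  ≈⟨ +-cong (gauss-n-n n) (*-congˡ (gauss-over (ℕ.n<1+n n))) ⟩
    1# + Q (suc n) * 0#                      ≈⟨ trans (+-congˡ (zeroʳ _)) (+-identityʳ 1#) ⟩
    1#                                       ∎

  gauss-poch : ∀ k m → gauss (k ℕ.+ m) k * P q k * P q m ≈ P q (k ℕ.+ m)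
  gauss-poch zero    m       = trans (*-congʳ (trans (*-congʳ (gauss-n-0 m)) (*-identityˡ 1#))) (*-identityˡ _)
  gauss-poch (suc k) zero    = begin
    gauss (suc k ℕ.+ 0) (suc k) * P q (suc k) * 1#
      ≡⟨ ≡.cong (λ n → gauss n (suc k) * P q (suc k) * 1#) (ℕ.+-identityʳ (suc k)) ⟩
    gauss (suc k) (suc k) * P q (suc k) * 1#
      ≈⟨ trans (*-identityʳ _) (trans (*-congʳ (gauss-n-n (suc k))) (*-identityˡ _)) ⟩
    P q (suc k)
      ≡⟨ ≡.cong (P q) (ℕ.+-identityʳ (suc k)) ⟨
    P q (suc k ℕ.+ 0) ∎
  gauss-poch (suc k) (suc m) = begin
    (gauss n k + Q (suc k) * gauss n (suc k)) * (P q k * (1# - q * Q k)) * (P q m * (1# - q * Q m))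
      ≈⟨ solve 7 (λ A B pk pm x y q →
                    (A :+ x :* q :* B) :* (pk :* (:1 :- q :* x)) :* (pm :* (:1 :- q :* y))
                    := A :* pk :* (pm :* (:1 :- q :* y)) :* (:1 :- q :* x)
                       :+ B :* (pk :* (:1 :- q :* x)) :* pm :* (x :* q :* (:1 :- q :* y)))
               refl (gauss n k) (gauss n (suc k)) (P q k) (P q m) (Q k) (Q m) q ⟩
    gauss n k * P q k * P q (suc m) * (1# - q * Q k)
      + gauss n (suc k) * P q (suc k) * P q m * (Q (suc k) * (1# - q * Q m))
      ≈⟨ +-cong (*-congʳ (gauss-poch k (suc m))) (*-congʳ shifted) ⟩
    P q n * (1# - q * Q k) + P q n * (Q (suc k) * (1# - q * Q m))
      ≈⟨ solve 4 (λ p x y q → p :* (:1 :- q :* x) :+ p :* (x :* q :* (:1 :- q :* y))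
                              := p :* (:1 :- q :* (x :* (y :* q)))) refl (P q n) (Q k) (Q m) q ⟩
    P q n * (1# - q * (Q k * Q (suc m)))
      ≈⟨ *-congˡ (+-congˡ (-‿cong (*-congˡ (sym (pow-+ q k (suc m)))))) ⟩
    P q n * (1# - q * Q n) ∎
    where
    n = k ℕ.+ suc m
    shifted : gauss n (suc k) * P q (suc k) * P q m ≈ P q n
    shifted = ≡.subst (λ i → gauss i (suc k) * P q (suc k) * P q m ≈ P q i) (≡.sym (ℕ.+-suc k m))
                      (gauss-poch (suc k) m)

  qbinom≈gauss : ∀ {N n} → n ≤ N → P q n * P q (N ∸ n) ≉ 0# → qbinom q N n ≈ gauss N n
  qbinom≈gauss {N} {n} n≤N ≉0 with n ℕ.≤? N
  ... | no n≰N = contradiction n≤N n≰N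
  ... | yes _  = ÷-unique ≉0 (begin
    gauss N n * (P q n * P q (N ∸ n))             ≈⟨ *-assoc _ _ _ ⟨
    gauss N n * P q n * P q (N ∸ n)               ≡⟨ ≡.cong (λ i → gauss i n * P q n * P q (N ∸ n)) (ℕ.m+[n∸m]≡n n≤N) ⟨
    gauss (n ℕ.+ (N ∸ n)) n * P q n * P q (N ∸ n) ≈⟨ gauss-poch n (N ∸ n) ⟩
    P q (n ℕ.+ (N ∸ n))                           ≡⟨ ≡.cong (P q) (ℕ.m+[n∸m]≡n n≤N) ⟩
    P q N                                         ∎)

  gauss-trinomial : ∀ k {j M} → (∀ i → i ≤ k ℕ.+ M → P q i ≉ 0#) → j ≤ M →
    gauss (k ℕ.+ M) (k ℕ.+ j) * gauss (k ℕ.+ j) k ≈ gauss (k ℕ.+ M) k * gauss M j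
  gauss-trinomial k {j} pochq≉0 j≤M with ℕ.m≤n⇒∃[o]m+o≡n j≤M
  ... | m , ≡.refl = *-cancelʳ Pk*Pj*Pm≉0 (begin
    gauss n (k ℕ.+ j) * gauss (k ℕ.+ j) k * (P q k * P q j * P q m)
      ≈⟨ solve 5 (λ a b x y z → a :* b :* (x :* y :* z) := a :* (b :* x :* y) :* z) refl _ _ _ _ _ ⟩
    gauss n (k ℕ.+ j) * (gauss (k ℕ.+ j) k * P q k * P q j) * P q m
      ≈⟨ *-congʳ (*-congˡ (gauss-poch k j)) ⟩
    gauss n (k ℕ.+ j) * P q (k ℕ.+ j) * P q m
      ≡⟨ ≡.cong (λ i → gauss i (k ℕ.+ j) * P q (k ℕ.+ j) * P q m) (ℕ.+-assoc k j m) ⟨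
    gauss (k ℕ.+ j ℕ.+ m) (k ℕ.+ j) * P q (k ℕ.+ j) * P q m
      ≈⟨ gauss-poch (k ℕ.+ j) m ⟩
    P q (k ℕ.+ j ℕ.+ m)
      ≡⟨ ≡.cong (P q) (ℕ.+-assoc k j m) ⟩
    P q n
      ≈⟨ gauss-poch k (j ℕ.+ m) ⟨
    gauss n k * P q k * P q (j ℕ.+ m)
      ≈⟨ *-congˡ (gauss-poch j m) ⟨
    gauss n k * P q k * (gauss (j ℕ.+ m) j * P q j * P q m)
      ≈⟨ solve 5 (λ a b x y z → a :* x :* (b :* y :* z) := a :* b :* (x :* y :* z)) refl _ _ _ _ _ ⟩
    gauss n k * gauss (j ℕ.+ m) j * (P q k * P q j * P q m) ∎)
    where
    n = k ℕ.+ (j ℕ.+ m)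
    Pk*Pj*Pm≉0 : P q k * P q j * P q m ≉ 0#
    Pk*Pj*Pm≉0 = x*y≉0 (x*y≉0 (pochq≉0 k (ℕ.m≤m+n k _))
                              (pochq≉0 j (ℕ.≤-trans (ℕ.m≤m+n j m) (ℕ.m≤n+m _ k))))
                       (pochq≉0 m (ℕ.≤-trans (ℕ.m≤n+m m j) (ℕ.m≤n+m _ k)))

  gaussSum : ℕ → (ℕ → Carrier) → Carrier
  gaussSum n f = sum< (suc n) (λ k → gauss n k * f k)

  gaussSum-cong : ∀ n {f g : ℕ → Carrier} → (∀ k → k ≤ n → f k ≈ g k) → gaussSum n f ≈ gaussSum n g
  gaussSum-cong n f≈g = sum<-cong (suc n) (λ k k<1+n → *-congˡ (f≈g k (ℕ.≤-pred k<1+n)))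

  gaussSum-+ : ∀ n (f g : ℕ → Carrier) → gaussSum n (λ k → f k + g k) ≈ gaussSum n f + gaussSum n g
  gaussSum-+ n f g = trans (sum<-cong (suc n) (λ k _ → distribˡ (gauss n k) (f k) (g k))) (sum<-+ (suc n) _ _)

  gaussSum-*ˡ : ∀ n x (f : ℕ → Carrier) → gaussSum n (λ k → x * f k) ≈ x * gaussSum n f
  gaussSum-*ˡ n x f =
    trans (sum<-cong (suc n) (λ k _ → x∙yz≈y∙xz (gauss n k) x (f k))) (sym (*-distribˡ-sum< (suc n) x _))

  gaussSum-extend : ∀ {n N} (f : ℕ → Carrier) → n ≤ N → gaussSum n f ≈ sum< (suc N) (λ k → gauss n k * f k)
  gaussSum-extend f n≤N = sum<-extend (s≤s n≤N) (λ k n<k → trans (*-congʳ (gauss-over n<k)) (zeroˡ _))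

  gaussSum≈sum1 : ∀ n (f : ℕ → Carrier) → f 0 ≈ 0# → gaussSum n f ≈ sum1 n (λ k → gauss n k * f k)
  gaussSum≈sum1 n f f0≈0 = begin
    sum< (suc n) (λ k → gauss n k * f k)                           ≈⟨ sum<-suc n _ ⟩
    gauss n 0 * f 0 + sum< n (λ k → gauss n (suc k) * f (suc k))
      ≈⟨ +-cong (trans (*-congˡ f0≈0) (zeroʳ _)) (sym (sum1≈sum< n _)) ⟩
    0# + sum1 n (λ k → gauss n k * f k)                            ≈⟨ +-identityˡ _ ⟩
    sum1 n (λ k → gauss n k * f k)                                 ∎

  gaussSum-pascal : ∀ n (f : ℕ → Carrier) → gaussSum (suc n) f ≈ gaussSum n (λ k → Q k * f k + f (suc k))
  gaussSum-pascal n f = begin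
    sum< (suc (suc n)) (λ k → gauss (suc n) k * f k)
      ≈⟨ sum<-suc (suc n) _ ⟩
    1# * f 0 + sum< (suc n) (λ k → (gauss n k + Q (suc k) * gauss n (suc k)) * f (suc k))
      ≈⟨ +-cong (*-identityˡ (f 0)) (trans (sum<-cong (suc n) (λ k _ → split k)) (sum<-+ (suc n) _ _)) ⟩
    f 0 + (A + sum< (suc n) (λ k → g (suc k)))
      ≈⟨ solve 3 (λ x a b → x :+ (a :+ b) := (x :+ b) :+ a) refl (f 0) A _ ⟩
    f 0 + sum< (suc n) (λ k → g (suc k)) + A
      ≈⟨ +-congʳ (trans (+-congʳ (sym g0≈f0)) (sym (sum<-suc (suc n) g))) ⟩
    sum< (suc n) g + g (suc n) + A
      ≈⟨ +-congʳ (trans (+-congˡ g[1+n]≈0) (+-identityʳ _)) ⟩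
    sum< (suc n) g + A
      ≈⟨ trans (sum<-cong (suc n) (λ k _ → distribˡ (gauss n k) _ _)) (sum<-+ (suc n) _ _) ⟨
    gaussSum n (λ k → Q k * f k + f (suc k)) ∎
    where
    g : ℕ → Carrier
    g k = gauss n k * (Q k * f k)
    A = sum< (suc n) (λ k → gauss n k * f (suc k))
    split : ∀ k → (gauss n k + Q (suc k) * gauss n (suc k)) * f (suc k) ≈ gauss n k * f (suc k) + g (suc k)
    split k = solve 4 (λ a x b y → (a :+ x :* b) :* y := a :* y :+ b :* (x :* y))
                refl (gauss n k) (Q (suc k)) (gauss n (suc k)) (f (suc k))
    g0≈f0 : g 0 ≈ f 0
    g0≈f0 = trans (*-congʳ (gauss-n-0 n)) (trans (*-identityˡ _) (*-identityˡ _))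
    g[1+n]≈0 : g (suc n) ≈ 0#
    g[1+n]≈0 = trans (*-congʳ (gauss-over (ℕ.n<1+n n))) (zeroˡ _)

module QVandermonde {c ℓ : Level} (F : Field c ℓ) (q : Field.Carrier F) where
  open Field F
  open FieldDefs F
  open FiniteSums commutativeRing
  open FieldProperties F
  open GaussianBinomials F q
  open IntegerCoefficientSolver commutativeRing
  open import Algebra.Properties.CommutativeSemigroup *-commutativeSemigroup using (x∙yz≈xz∙y; xy∙z≈xz∙y)
  open import Relation.Binary.Reasoning.Setoid setoid

  private
    Q : ℕ → Carrier
    Q = pow q

    P : Carrier → ℕ → Carrier
    P = poch q

  poch-pow-shift : ∀ b Y {j M} → j ≤ M →
    Q j * (Y * P b (suc M ∸ j) * pow b j) ≈ (1# - b) * (Y * P (b * q) (M ∸ j) * pow (b * q) j)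
  poch-pow-shift b Y {j} {M} j≤M = begin
    Q j * (Y * P b (suc M ∸ j) * pow b j)                 ≈⟨ *-congˡ (*-congʳ (*-congˡ (poch-suc-∸ b j≤M))) ⟩
    Q j * (Y * ((1# - b) * P (b * q) (M ∸ j)) * pow b j)
      ≈⟨ solve 5 (λ x y b p z → x :* (y :* ((:1 :- b) :* p) :* z) := (:1 :- b) :* (y :* p :* (z :* x)))
               refl (Q j) Y b _ (pow b j) ⟩
    (1# - b) * (Y * P (b * q) (M ∸ j) * (pow b j * Q j))  ≈⟨ *-congˡ (*-congˡ (pow-distrib-* b q j)) ⟨
    (1# - b) * (Y * P (b * q) (M ∸ j) * pow (b * q) j)    ∎

  q-vandermonde : ∀ M y b → gaussSum M (λ j → P y j * P b (M ∸ j) * pow b j) ≈ P (b * y) M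
  q-vandermonde zero    y b = solve 0 (:0 :+ :1 :* (:1 :* :1 :* :1) := :1) refl
  q-vandermonde (suc M) y b = begin
    gaussSum (suc M) (λ j → P y j * P b (suc M ∸ j) * pow b j)
      ≈⟨ gaussSum-pascal M _ ⟩
    gaussSum M (λ j → Q j * (P y j * P b (suc M ∸ j) * pow b j) + P y (suc j) * P b (M ∸ j) * pow b (suc j))
      ≈⟨ gaussSum-cong M (λ j j≤M → +-cong (poch-pow-shift b (P y j) j≤M) (lower j)) ⟩
    gaussSum M (λ j → (1# - b) * (P y j * P (b * q) (M ∸ j) * pow (b * q) j)
                      + b * (1# - y) * (P (y * q) j * P b (M ∸ j) * pow b j))
      ≈⟨ trans (gaussSum-+ M _ _) (+-cong (gaussSum-*ˡ M _ _) (gaussSum-*ˡ M _ _)) ⟩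
    (1# - b) * gaussSum M (λ j → P y j * P (b * q) (M ∸ j) * pow (b * q) j)
      + b * (1# - y) * gaussSum M (λ j → P (y * q) j * P b (M ∸ j) * pow b j)
      ≈⟨ +-cong (*-congˡ (q-vandermonde M y (b * q))) (*-congˡ (q-vandermonde M (y * q) b)) ⟩
    (1# - b) * P (b * q * y) M + b * (1# - y) * P (b * (y * q)) M
      ≈⟨ +-cong (*-congˡ (poch-cong M (xy∙z≈xz∙y b q y))) (*-congˡ (poch-cong M (sym (*-assoc b y q)))) ⟩
    (1# - b) * P (b * y * q) M + b * (1# - y) * P (b * y * q) M
      ≈⟨ solve 3 (λ b y p → (:1 :- b) :* p :+ b :* (:1 :- y) :* p := (:1 :- b :* y) :* p) refl b y _ ⟩
    (1# - b * y) * P (b * y * q) M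
      ≈⟨ poch-suc (b * y) M ⟨
    P (b * y) (suc M) ∎
    where
    lower : ∀ j → P y (suc j) * P b (M ∸ j) * pow b (suc j) ≈ b * (1# - y) * (P (y * q) j * P b (M ∸ j) * pow b j)
    lower j = trans (*-congʳ (*-congʳ (poch-suc y j)))
      (solve 5 (λ y p r z b → (:1 :- y) :* p :* r :* (z :* b) := b :* (:1 :- y) :* (p :* r :* z))
         refl y (P (y * q) j) (P b (M ∸ j)) (pow b j) b)

  -- (q)_{n-1}, extended by 0 at n = 0: the y-derivative of (y)_n at y = 1, up to sign.
  pochPred : ℕ → Carrier
  pochPred zero    = 0#
  pochPred (suc n) = P q n

  -- -b ∂/∂b log (b)_M
  logDerivative : Carrier → ℕ → Carrier
  logDerivative b M = sum1 M (λ n → (b * pow q (n ∸ 1)) ÷ (1# - b * pow q (n ∸ 1)))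

  logDerivative-suc : ∀ b M → logDerivative b (suc M) ≈ b ÷ (1# - b) + logDerivative (b * q) M
  logDerivative-suc b M = trans (sum1-suc M _)
    (+-cong (÷-cong (*-identityʳ b) (+-congˡ (-‿cong (*-identityʳ b))))
            (sum1-cong M (λ n _ → ÷-cong (shift n) (+-congˡ (-‿cong (shift n))))))
    where
    shift : ∀ n → b * Q (suc n) ≈ b * q * Q n
    shift n = x∙yz≈xz∙y b (Q n) q

  q-vandermonde-derivative : ∀ M b → (∀ n → n < M → 1# - b * Q n ≉ 0#) →
    gaussSum M (λ j → pochPred j * P b (M ∸ j) * pow b j) ≈ P b M * logDerivative b M
  q-vandermonde-derivative zero    b _ = solve 0 (:0 :+ :1 :* (:0 :* :1 :* :1) := :1 :* :0) refl
  q-vandermonde-derivative (suc M) b 1-bqⁿ≉0 = begin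
    gaussSum (suc M) (λ j → pochPred j * P b (suc M ∸ j) * pow b j)
      ≈⟨ gaussSum-pascal M _ ⟩
    gaussSum M (λ j → Q j * (pochPred j * P b (suc M ∸ j) * pow b j) + P q j * P b (M ∸ j) * pow b (suc j))
      ≈⟨ gaussSum-cong M (λ j j≤M → +-cong (poch-pow-shift b (pochPred j) j≤M) (lower j)) ⟩
    gaussSum M (λ j → (1# - b) * (pochPred j * P (b * q) (M ∸ j) * pow (b * q) j)
                      + b * (P q j * P b (M ∸ j) * pow b j))
      ≈⟨ trans (gaussSum-+ M _ _) (+-cong (gaussSum-*ˡ M _ _) (gaussSum-*ˡ M _ _)) ⟩
    (1# - b) * gaussSum M (λ j → pochPred j * P (b * q) (M ∸ j) * pow (b * q) j)
      + b * gaussSum M (λ j → P q j * P b (M ∸ j) * pow b j)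
      ≈⟨ +-cong (*-congˡ (q-vandermonde-derivative M (b * q) 1-bqqⁿ≉0)) (*-congˡ (q-vandermonde M q b)) ⟩
    (1# - b) * (P (b * q) M * L) + b * P (b * q) M
      ≈⟨ +-congˡ (*-congʳ (÷-*-cancel 1-b≉0)) ⟨
    (1# - b) * (P (b * q) M * L) + b ÷ (1# - b) * (1# - b) * P (b * q) M
      ≈⟨ solve 4 (λ b p l d → (:1 :- b) :* (p :* l) :+ d :* (:1 :- b) :* p := (:1 :- b) :* p :* (d :+ l))
               refl b _ L _ ⟩
    (1# - b) * P (b * q) M * (b ÷ (1# - b) + L)
      ≈⟨ *-cong (poch-suc b M) (logDerivative-suc b M) ⟨
    P b (suc M) * logDerivative b (suc M) ∎
    where
    L = logDerivative (b * q) M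
    lower : ∀ j → P q j * P b (M ∸ j) * pow b (suc j) ≈ b * (P q j * P b (M ∸ j) * pow b j)
    lower j = solve 4 (λ x y z b → x :* y :* (z :* b) := b :* (x :* y :* z)) refl (P q j) (P b (M ∸ j)) (pow b j) b
    1-b≉0 : 1# - b ≉ 0#
    1-b≉0 = ≉0-resp-≈ (+-congˡ (-‿cong (*-identityʳ b))) (1-bqⁿ≉0 0 (s≤s z≤n))
    1-bqqⁿ≉0 : ∀ n → n < M → 1# - b * q * Q n ≉ 0#
    1-bqqⁿ≉0 n n<M = ≉0-resp-≈ (+-congˡ (-‿cong (x∙yz≈xz∙y b (Q n) q))) (1-bqⁿ≉0 (suc n) (s≤s n<M))

  chuWeight : Carrier → Carrier → ℕ → Carrier
  chuWeight u x zero    = 1#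
  chuWeight u x (suc k) = chuWeight u x k * ((Q k - u) * x * Q k)

  chuWeight-*q : ∀ u x k → chuWeight u (x * q) k ≈ Q k * chuWeight u x k
  chuWeight-*q u x zero    = sym (*-identityˡ 1#)
  chuWeight-*q u x (suc k) = begin
    chuWeight u (x * q) k * ((Q k - u) * (x * q) * Q k)
      ≈⟨ *-congʳ (chuWeight-*q u x k) ⟩
    Q k * chuWeight u x k * ((Q k - u) * (x * q) * Q k)
      ≈⟨ solve 5 (λ a w u x q → a :* w :* ((a :- u) :* (x :* q) :* a) := a :* q :* (w :* ((a :- u) :* x :* a)))
               refl (Q k) _ u x q ⟩
    Q (suc k) * chuWeight u x (suc k) ∎

  poch-expansion : ∀ u n m x →
    gaussSum n (λ k → chuWeight u x k * P (x * Q k) (n ∸ k ℕ.+ m)) ≈ P (u * x) n * P (x * Q n) m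
  poch-expansion u zero    m x = solve 1 (λ p → :0 :+ :1 :* (:1 :* p) := :1 :* p) refl (P (x * 1#) m)
  poch-expansion u (suc n) m x = begin
    gaussSum (suc n) (λ k → chuWeight u x k * P (x * Q k) (suc n ∸ k ℕ.+ m))
      ≈⟨ gaussSum-pascal n _ ⟩
    gaussSum n (λ k → Q k * (chuWeight u x k * P (x * Q k) (suc n ∸ k ℕ.+ m))
                      + chuWeight u x (suc k) * P (x * Q (suc k)) (n ∸ k ℕ.+ m))
      ≈⟨ gaussSum-cong n step ⟩
    gaussSum n (λ k → (1# - u * x) * (chuWeight u (x * q) k * P (x * q * Q k) (n ∸ k ℕ.+ m)))
      ≈⟨ gaussSum-*ˡ n _ _ ⟩
    (1# - u * x) * gaussSum n (λ k → chuWeight u (x * q) k * P (x * q * Q k) (n ∸ k ℕ.+ m))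
      ≈⟨ *-congˡ (poch-expansion u n m (x * q)) ⟩
    (1# - u * x) * (P (u * (x * q)) n * P (x * q * Q n) m)
      ≈⟨ *-congˡ (*-cong (poch-cong n (*-assoc u x q)) (poch-cong m (x∙yz≈xz∙y x (Q n) q))) ⟨
    (1# - u * x) * (P (u * x * q) n * P (x * Q (suc n)) m)
      ≈⟨ trans (*-congʳ (poch-suc (u * x) n)) (*-assoc _ _ _) ⟨
    P (u * x) (suc n) * P (x * Q (suc n)) m ∎
    where
    step : ∀ k → k ≤ n →
      Q k * (chuWeight u x k * P (x * Q k) (suc n ∸ k ℕ.+ m)) + chuWeight u x (suc k) * P (x * Q (suc k)) (n ∸ k ℕ.+ m)
      ≈ (1# - u * x) * (chuWeight u (x * q) k * P (x * q * Q k) (n ∸ k ℕ.+ m))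
    step k k≤n = begin
      Q k * (W * P (x * Q k) (suc n ∸ k ℕ.+ m)) + W * ((Q k - u) * x * Q k) * P (x * Q (suc k)) r
        ≈⟨ +-cong (*-congˡ (*-congˡ (trans (reflexive (≡.cong (λ i → P (x * Q k) (i ℕ.+ m)) (ℕ.+-∸-assoc 1 k≤n)))
                                           (poch-suc (x * Q k) r))))
                  (*-congˡ (poch-cong r (sym (*-assoc x (Q k) q)))) ⟩
      Q k * (W * ((1# - x * Q k) * R)) + W * ((Q k - u) * x * Q k) * R
        ≈⟨ solve 5 (λ a w r x u → a :* (w :* ((:1 :- x :* a) :* r)) :+ w :* ((a :- u) :* x :* a) :* r
                                  := (:1 :- u :* x) :* (a :* w :* r)) refl (Q k) W R x u ⟩
      (1# - u * x) * (Q k * W * R)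
        ≈⟨ *-congˡ (*-cong (chuWeight-*q u x k) (poch-cong r (xy∙z≈xz∙y x q (Q k)))) ⟨
      (1# - u * x) * (chuWeight u (x * q) k * P (x * q * Q k) r) ∎
      where
      W = chuWeight u x k
      r = n ∸ k ℕ.+ m
      R = P (x * Q k * q) r

  numerator≈chuWeight : ∀ {a b e u v x} → v * a ≈ b → u * b ≈ a → x * e ≈ q → ∀ n →
    pow (- 1#) n * P v n * pow a n * pow q (tri n) ≈ pow e n * pow b n * chuWeight u x n
  numerator≈chuWeight va≈b ub≈a xe≈q zero = solve 0 (:1 :* :1 :* :1 :* :1 := :1 :* :1 :* :1) refl
  numerator≈chuWeight {a} {b} {e} {u} {v} {x} va≈b ub≈a xe≈q (suc n) = begin
    pow (- 1#) n * - 1# * (P v n * (1# - v * Q n)) * (pow a n * a) * pow q (tri (suc n))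
      ≈⟨ *-congˡ (trans (reflexive (≡.cong (pow q) (tri-suc n))) (pow-+ q (tri n) (suc n))) ⟩
    pow (- 1#) n * - 1# * (P v n * (1# - v * Q n)) * (pow a n * a) * (pow q (tri n) * (Q n * q))
      ≈⟨ solve 8 (λ s p A t v Qn a q → s :* (:- :1) :* (p :* (:1 :- v :* Qn)) :* (A :* a) :* (t :* (Qn :* q))
                                      := s :* p :* A :* t :* ((v :* a :* Qn :- a) :* Qn :* q))
               refl (pow (- 1#) n) (P v n) (pow a n) (pow q (tri n)) v (Q n) a q ⟩
    pow (- 1#) n * P v n * pow a n * pow q (tri n) * ((v * a * Q n - a) * Q n * q)
      ≈⟨ *-cong (numerator≈chuWeight va≈b ub≈a xe≈q n)
                (*-cong (*-congʳ (+-cong (*-congʳ va≈b) (-‿cong (sym ub≈a)))) (sym xe≈q)) ⟩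
    pow e n * pow b n * chuWeight u x n * ((b * Q n - u * b) * Q n * (x * e))
      ≈⟨ solve 8 (λ E B w b Qn u x e → E :* B :* w :* ((b :* Qn :- u :* b) :* Qn :* (x :* e))
                                       := E :* e :* (B :* b) :* (w :* ((Qn :- u) :* x :* Qn)))
               refl (pow e n) (pow b n) (chuWeight u x n) b (Q n) u x e ⟩
    pow e (suc n) * pow b (suc n) * chuWeight u x (suc n) ∎

  gaussSum-gauss-pochPred : ∀ k M b → (∀ i → i ≤ suc k ℕ.+ M → P q i ≉ 0#) →
    gaussSum (suc k ℕ.+ M) (λ n → gauss n (suc k) * (pochPred n * P b (suc k ℕ.+ M ∸ n) * pow b n))
    ≈ gauss (suc k ℕ.+ M) (suc k) * (pochPred (suc k) * pow b (suc k)) * P (b * Q (suc k)) M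
  gaussSum-gauss-pochPred k M b pochq≉0 = begin
    sum< (suc (K ℕ.+ M)) f
      ≡⟨ ≡.cong (λ i → sum< i f) (ℕ.+-suc K M) ⟨
    sum< (K ℕ.+ suc M) f
      ≈⟨ sum<-+-range K (suc M) f ⟩
    sum< K f + sum< (suc M) (λ j → f (K ℕ.+ j))
      ≈⟨ +-cong (sum<-zero K (λ n n<K → trans (*-congˡ (trans (*-congʳ (gauss-over n<K)) (zeroˡ _))) (zeroʳ _)))
                (sum<-cong (suc M) (λ j j<1+M → term j (ℕ.≤-pred j<1+M))) ⟩
    0# + sum< (suc M) (λ j → coeff * (gauss M j * (P (Q K) j * P b (M ∸ j) * pow b j)))
      ≈⟨ trans (+-identityˡ _) (sym (*-distribˡ-sum< (suc M) coeff _)) ⟩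
    coeff * gaussSum M (λ j → P (Q K) j * P b (M ∸ j) * pow b j)
      ≈⟨ *-congˡ (q-vandermonde M (Q K) b) ⟩
    coeff * P (b * Q K) M ∎
    where
    K = suc k
    N = K ℕ.+ M
    f : ℕ → Carrier
    f n = gauss N n * (gauss n K * (pochPred n * P b (N ∸ n) * pow b n))
    coeff = gauss N K * (pochPred K * pow b K)
    term : ∀ j → j ≤ M → f (K ℕ.+ j) ≈ coeff * (gauss M j * (P (Q K) j * P b (M ∸ j) * pow b j))
    term j j≤M = begin
      gauss N (K ℕ.+ j) * (gauss (K ℕ.+ j) K * (P q (k ℕ.+ j) * P b (N ∸ (K ℕ.+ j)) * pow b (K ℕ.+ j)))
        ≈⟨ *-congˡ (*-congˡ (*-cong (*-cong (trans (poch-+ q k j) (*-congˡ (poch-cong j (*-comm q (Q k)))))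
                                             (reflexive (≡.cong (P b) (ℕ.[m+n]∸[m+o]≡n∸o K M j))))
                                    (pow-+ b K j))) ⟩
      gauss N (K ℕ.+ j) * (gauss (K ℕ.+ j) K * (P q k * P (Q K) j * P b (M ∸ j) * (pow b K * pow b j)))
        ≈⟨ solve 7 (λ a b h y p x z → a :* (b :* (h :* y :* p :* (x :* z))) := a :* b :* (h :* x) :* (y :* p :* z))
                 refl _ _ (P q k) _ _ (pow b K) (pow b j) ⟩
      gauss N (K ℕ.+ j) * gauss (K ℕ.+ j) K * (P q k * pow b K) * (P (Q K) j * P b (M ∸ j) * pow b j)
        ≈⟨ *-congʳ (*-congʳ (gauss-trinomial K pochq≉0 j≤M)) ⟩
      gauss N K * gauss M j * (P q k * pow b K) * (P (Q K) j * P b (M ∸ j) * pow b j)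
        ≈⟨ solve 4 (λ a b h v → a :* b :* h :* v := a :* h :* (b :* v)) refl _ _ _ _ ⟩
      coeff * (gauss M j * (P (Q K) j * P b (M ∸ j) * pow b j)) ∎

  cleared-identity : ∀ N b u x → (∀ i → i ≤ N → P q i ≉ 0#) →
    sum1 N (λ n → gauss N n * (pochPred n * P b (N ∸ n) * pow b n * (P (u * x) n * P (x * Q n) (N ∸ n))))
    ≈ P x N * gaussSum N (λ n → pochPred n * P b (N ∸ n) * pow b n)
      + sum1 N (λ n → gauss N n * (pochPred n * pow b n * P (b * Q n) (N ∸ n)
                                   * (chuWeight u x n * P (x * Q n) (N ∸ n))))
  cleared-identity N b u x pochq≉0 = begin
    sum1 N (λ n → gauss N n * (T n * (P (u * x) n * P (x * Q n) (N ∸ n))))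
      ≈⟨ gaussSum≈sum1 N _ (trans (*-congʳ (trans (*-congʳ (zeroˡ _)) (zeroˡ _))) (zeroˡ _)) ⟨
    gaussSum N (λ n → T n * (P (u * x) n * P (x * Q n) (N ∸ n)))
      ≈⟨ sum<-cong (suc N) (λ n n<1+N → expand n (ℕ.≤-pred n<1+N)) ⟩
    sum< (suc N) (λ n → gauss N n * T n * sum< (suc N) (λ k → gauss n k * V k))
      ≈⟨ sum<-interchange (suc N) (suc N) _ _ ⟩
    sum< (suc N) (λ k → sum< (suc N) (λ n → gauss N n * T n * (gauss n k * V k)))
      ≈⟨ sum<-cong (suc N) (λ k _ → factor k) ⟩
    sum< (suc N) (λ k → B k * V k)
      ≈⟨ sum<-suc N _ ⟩
    B 0 * V 0 + sum< N (λ k → B (suc k) * V (suc k))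
      ≈⟨ +-cong (trans (*-comm _ _) (*-cong V0≈PxN B0≈K)) (trans (sum<-cong N Bₖ₊₁Vₖ₊₁) (sym (sum1≈sum< N _))) ⟩
    P x N * gaussSum N T + sum1 N (λ n → gauss N n * (pochPred n * pow b n * P (b * Q n) (N ∸ n) * V n)) ∎
    where
    T V B : ℕ → Carrier
    T n = pochPred n * P b (N ∸ n) * pow b n
    V k = chuWeight u x k * P (x * Q k) (N ∸ k)
    B k = gaussSum N (λ n → gauss n k * T n)

    expand : ∀ n → n ≤ N → gauss N n * (T n * (P (u * x) n * P (x * Q n) (N ∸ n)))
                          ≈ gauss N n * T n * sum< (suc N) (λ k → gauss n k * V k)
    expand n n≤N = trans (sym (*-assoc _ _ _)) (*-congˡ (begin
      P (u * x) n * P (x * Q n) (N ∸ n)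
        ≈⟨ poch-expansion u n (N ∸ n) x ⟨
      gaussSum n (λ k → chuWeight u x k * P (x * Q k) (n ∸ k ℕ.+ (N ∸ n)))
        ≈⟨ gaussSum-cong n (λ k k≤n → *-congˡ (reflexive (≡.cong (P (x * Q k)) (m∸k+[n∸m]≡n∸k k≤n n≤N)))) ⟩
      gaussSum n V
        ≈⟨ gaussSum-extend V n≤N ⟩
      sum< (suc N) (λ k → gauss n k * V k) ∎))

    factor : ∀ k → sum< (suc N) (λ n → gauss N n * T n * (gauss n k * V k)) ≈ B k * V k
    factor k = trans (sum<-cong (suc N) (λ n _ → solve 4 (λ a t b v → a :* t :* (b :* v) := a :* (b :* t) :* v)
                                                         refl _ _ _ _))
                     (sym (*-distribʳ-sum< (suc N) _ _))

    B0≈K : B 0 ≈ gaussSum N T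
    B0≈K = sum<-cong (suc N) (λ n _ → *-congˡ (trans (*-congʳ (gauss-n-0 n)) (*-identityˡ _)))

    V0≈PxN : V 0 ≈ P x N
    V0≈PxN = trans (*-identityˡ _) (poch-cong N (*-identityʳ x))

    Bₖ₊₁Vₖ₊₁ : ∀ k → k < N →
      B (suc k) * V (suc k) ≈ gauss N (suc k) * (pochPred (suc k) * pow b (suc k) * P (b * Q (suc k)) (N ∸ suc k) * V (suc k))
    Bₖ₊₁Vₖ₊₁ k k<N with ℕ.m≤n⇒∃[o]m+o≡n k<N
    ... | M , ≡.refl = begin
      B (suc k) * V (suc k)
        ≈⟨ *-congʳ (gaussSum-gauss-pochPred k M b pochq≉0) ⟩
      gauss N (suc k) * (pochPred (suc k) * pow b (suc k)) * P (b * Q (suc k)) M * V (suc k)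
        ≡⟨ ≡.cong (λ i → gauss N (suc k) * (pochPred (suc k) * pow b (suc k)) * P (b * Q (suc k)) i * V (suc k))
                  (ℕ.m+n∸m≡n (suc k) M) ⟨
      gauss N (suc k) * (pochPred (suc k) * pow b (suc k)) * P (b * Q (suc k)) (N ∸ suc k) * V (suc k)
        ≈⟨ solve 5 (λ g h x p v → g :* (h :* x) :* p :* v := g :* (h :* x :* p :* v)) refl _ _ _ _ _ ⟩
      gauss N (suc k) * (pochPred (suc k) * pow b (suc k) * P (b * Q (suc k)) (N ∸ suc k) * V (suc k)) ∎
module ClearedSummands {c ℓ : Level} (F : Field c ℓ) (N : ℕ) (q a b e : Field.Carrier F) where
  open Field F
  open FieldDefs F
  open FieldProperties F
  open GaussianBinomials F q
  open QVandermonde F q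
  open IntegerCoefficientSolver commutativeRing
  open import Relation.Binary.Reasoning.Setoid setoid

  private
    Q : ℕ → Carrier
    Q = pow q

    P : Carrier → ℕ → Carrier
    P = poch q

  x u : Carrier
  x = q ÷ e
  u = a ÷ b

  Nondegenerate : Set ℓ
  Nondegenerate = ∀ n → 1 ≤ n → n ≤ N →
    (P q n * P q (N ∸ n) ≉ 0#) × (P b n ≉ 0#) × (P x n ≉ 0#) × (1# - b * Q (n ∸ 1) ≉ 0#)

  lhsSummand rhsSummand clearedLhs clearedRhs : ℕ → Carrier
  lhsSummand n = qbinom q N n *
    ((pow (- 1#) n * P q (n ∸ 1) * P (b ÷ a) n * pow a n * pow q (tri n)) ÷ (P b n * P x n * pow e n))
  rhsSummand n = qbinom q N n *
    ((P q (n ∸ 1) * P b (N ∸ n) * P (a * q ÷ (b * e)) n * pow b n) ÷ (P b N * P x n))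
  clearedLhs n =
    gauss N n * (pochPred n * pow b n * P (b * Q n) (N ∸ n) * (chuWeight u x n * P (x * Q n) (N ∸ n)))
  clearedRhs n =
    gauss N n * (pochPred n * P b (N ∸ n) * pow b n * (P (u * x) n * P (x * Q n) (N ∸ n)))

  D : Carrier
  D = P b N * P x N

  D≉0 : Nondegenerate → P b N ≉ 0# → D ≉ 0#
  D≉0 nd PbN≉0 = x*y≉0 PbN≉0 (poch≉0-from-1 (λ n 1≤n n≤N → proj₁ (proj₂ (proj₂ (nd n 1≤n n≤N)))))

  lhsSummand-cleared : a ≉ 0# → b ≉ 0# → e ≉ 0# → Nondegenerate →
    ∀ n → n < N → lhsSummand (suc n) * D ≈ clearedLhs (suc n)
  lhsSummand-cleared a≉0 b≉0 e≉0 nd n n<N = begin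
    qbinom q N K * (Num ÷ Den) * D        ≈⟨ trans (*-assoc _ _ _) (*-congʳ (qbinom≈gauss n<N (proj₁ nondeg))) ⟩
    gauss N K * (Num ÷ Den * D)           ≈⟨ *-congˡ (*-cancelʳ (pow-≉0 K e≉0) cleared) ⟩
    clearedLhs K                          ∎
    where
    K = suc n
    nondeg = nd K (s≤s z≤n) n<N
    Num = pow (- 1#) K * P q n * P (b ÷ a) K * pow a K * pow q (tri K)
    Den = P b K * P x K * pow e K
    Rb = P (b * Q K) (N ∸ K)
    Rx = P (x * Q K) (N ∸ K)
    W = chuWeight u x K
    Den≉0 : Den ≉ 0#
    Den≉0 = x*y≉0 (x*y≉0 (proj₁ (proj₂ nondeg)) (proj₁ (proj₂ (proj₂ nondeg)))) (pow-≉0 K e≉0)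
    cleared : Num ÷ Den * D * pow e K ≈ P q n * pow b K * Rb * (W * Rx) * pow e K
    cleared = begin
      Num ÷ Den * D * pow e K
        ≈⟨ trans (*-assoc _ _ _) (*-congˡ (*-congʳ (*-cong (poch-split b n<N) (poch-split x n<N)))) ⟩
      Num ÷ Den * (P b K * Rb * (P x K * Rx) * pow e K)
        ≈⟨ *-congˡ (solve 5 (λ pb rb px rx ek → pb :* rb :* (px :* rx) :* ek := pb :* px :* ek :* (rb :* rx))
                            refl _ _ _ _ _) ⟩
      Num ÷ Den * (Den * (Rb * Rx))
        ≈⟨ trans (sym (*-assoc _ _ _)) (*-congʳ (÷-*-cancel Den≉0)) ⟩
      Num * (Rb * Rx)
        ≈⟨ *-congʳ (solve 5 (λ s h v a t → s :* h :* v :* a :* t := h :* (s :* v :* a :* t)) refl _ _ _ _ _) ⟩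
      P q n * (pow (- 1#) K * P (b ÷ a) K * pow a K * pow q (tri K)) * (Rb * Rx)
        ≈⟨ *-congʳ (*-congˡ (numerator≈chuWeight (÷-*-cancel a≉0) (÷-*-cancel b≉0) (÷-*-cancel e≉0) K)) ⟩
      P q n * (pow e K * pow b K * W) * (Rb * Rx)
        ≈⟨ solve 6 (λ h ek bk w rb rx → h :* (ek :* bk :* w) :* (rb :* rx) := h :* bk :* rb :* (w :* rx) :* ek)
                 refl _ _ _ _ _ _ ⟩
      P q n * pow b K * Rb * (W * Rx) * pow e K ∎

  rhsSummand-cleared : b ≉ 0# → e ≉ 0# → Nondegenerate → P b N ≉ 0# →
    ∀ n → n < N → rhsSummand (suc n) * D ≈ clearedRhs (suc n)
  rhsSummand-cleared b≉0 e≉0 nd PbN≉0 n n<N = begin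
    qbinom q N K * (Num ÷ Den) * D
      ≈⟨ trans (*-assoc _ _ _) (*-congʳ (qbinom≈gauss n<N (proj₁ nondeg))) ⟩
    gauss N K * (Num ÷ Den * D)
      ≈⟨ *-congˡ (*-congˡ (trans (*-congˡ (poch-split x n<N)) (sym (*-assoc _ _ _)))) ⟩
    gauss N K * (Num ÷ Den * (Den * Rx))
      ≈⟨ *-congˡ (trans (sym (*-assoc _ _ _)) (*-congʳ (÷-*-cancel Den≉0))) ⟩
    gauss N K * (Num * Rx)
      ≈⟨ *-congˡ (*-congʳ (*-congʳ (*-congˡ (poch-cong K aq/be≈ux)))) ⟩
    gauss N K * (P q n * P b (N ∸ K) * P (u * x) K * pow b K * Rx)
      ≈⟨ *-congˡ (solve 5 (λ h pb p bk rx → h :* pb :* p :* bk :* rx := h :* pb :* bk :* (p :* rx)) refl _ _ _ _ _) ⟩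
    clearedRhs K ∎
    where
    K = suc n
    nondeg = nd K (s≤s z≤n) n<N
    Num = P q n * P b (N ∸ K) * P (a * q ÷ (b * e)) K * pow b K
    Den = P b N * P x K
    Rx = P (x * Q K) (N ∸ K)
    Den≉0 : Den ≉ 0#
    Den≉0 = x*y≉0 PbN≉0 (proj₁ (proj₂ (proj₂ nondeg)))
    aq/be≈ux : a * q ÷ (b * e) ≈ u * x
    aq/be≈ux = ÷-unique (x*y≉0 b≉0 e≉0) (begin
      u * x * (b * e)     ≈⟨ solve 4 (λ u x b e → u :* x :* (b :* e) := u :* b :* (x :* e)) refl u x b e ⟩
      u * b * (x * e)     ≈⟨ *-cong (÷-*-cancel b≉0) (÷-*-cancel e≉0) ⟩
      a * q               ∎)

  pochq≉0 : Nondegenerate → ∀ i → i ≤ N → P q i ≉ 0#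
  pochq≉0 nd zero    _   = 1≉0
  pochq≉0 nd (suc i) i<N = x*y≉0⇒x≉0 (proj₁ (nd (suc i) (s≤s z≤n) i<N))

  cleared-sums : Nondegenerate → sum1 N clearedRhs ≈ P x N * (P b N * logDerivative b N) + sum1 N clearedLhs
  cleared-sums nd = trans (cleared-identity N b u x (pochq≉0 nd))
                          (+-congʳ (*-congˡ (q-vandermonde-derivative N b 1-bqⁿ≉0)))
    where
    1-bqⁿ≉0 : ∀ n → n < N → 1# - b * Q n ≉ 0#
    1-bqⁿ≉0 n n<N = proj₂ (proj₂ (proj₂ (nd (suc n) (s≤s z≤n) n<N)))

theorem5p6 : ∀ {c ℓ : Level} (F : Field c ℓ) →
    let open Field F in let open FieldDefs F in
    (N : ℕ) (q a b e : Carrier) →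
    ¬ (a ≈ 0#) → ¬ (b ≈ 0#) → ¬ (e ≈ 0#) →
    (∀ n → 1 ≤ n → n ≤ N →
      (¬ (poch q q n * poch q q (N ∸ n) ≈ 0#)) × (¬ (poch q b n ≈ 0#)) ×
      (¬ (poch q (q ÷ e) n ≈ 0#)) × (¬ (1# - b * pow q (n ∸ 1) ≈ 0#))) →
    ¬ (poch q b N ≈ 0#) →
    sum1 N (λ n → qbinom q N n *
        ((pow (- 1#) n * poch q q (n ∸ 1) * poch q (b ÷ a) n * pow a n * pow q (tri n))
          ÷ (poch q b n * poch q (q ÷ e) n * pow e n)))
    ≈
    sum1 N (λ n → qbinom q N n *
        ((poch q q (n ∸ 1) * poch q b (N ∸ n) * poch q (a * q ÷ (b * e)) n * pow b n)
          ÷ (poch q b N * poch q (q ÷ e) n)))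
    - sum1 N (λ n → (b * pow q (n ∸ 1)) ÷ (1# - b * pow q (n ∸ 1)))
theorem5p6 F N q a b e a≉0 b≉0 e≉0 nd PbN≉0 = *-cancelʳ (D≉0 nd PbN≉0) (begin
    sum1 N lhsSummand * D
      ≈⟨ trans (*-distribʳ-sum1 N D _) (sum1-cong N (lhsSummand-cleared a≉0 b≉0 e≉0 nd)) ⟩
    sum1 N clearedLhs
      ≈⟨ solve 2 (λ l y → l := y :+ l :- y) refl _ Y ⟩
    Y + sum1 N clearedLhs - Y
      ≈⟨ +-congʳ (cleared-sums nd) ⟨
    sum1 N clearedRhs - Y
      ≈⟨ +-congʳ (trans (*-distribʳ-sum1 N D _) (sum1-cong N (rhsSummand-cleared b≉0 e≉0 nd PbN≉0))) ⟨
    sum1 N rhsSummand * D - Y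
      ≈⟨ solve 4 (λ r h pb px → r :* (pb :* px) :- px :* (pb :* h) := (r :- h) :* (pb :* px))
               refl _ (logDerivative b N) (poch q b N) (poch q x N) ⟩
    (sum1 N rhsSummand - logDerivative b N) * D ∎)
  where
  open Field F
  open FieldDefs F
  open FieldProperties F
  open QVandermonde F q
  open ClearedSummands F N q a b e
  open IntegerCoefficientSolver commutativeRing
  open import Relation.Binary.Reasoning.Setoid setoid
  Y = poch q x N * (poch q b N * logDerivative b N)
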